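{- Let $n\ge 2$ targets $\mathcal T=\{1,\dots,n\}$ be given with travel times $c(u,v)>0$ ($u\ne v$) satisfying the triangle inequality. Let $n+1\le k\le 2n-1$ and let $\mathcal W^*(k)=(v_1,\dots,v_{k+1})$ be a closed walk with $k$ visits with $\mathcal R(\mathcal W^*(k))=\mathcal R^*(k)$. Let $\mathcal W(k-1)=(v_1,\dots,v_{s-1},v_{s+1},\dots,v_{k+1})$ be a shortcut walk of $\mathcal W^*(k)$ with $k-1$ visits, i.e. obtained by deleting an entry $v_s$ with $2\le s\le k$ that is not the last occurrence of its target (there is $t$ with $s<t\le k+1$ and $v_t=v_s$), with $v_{s-1}\ne v_{s+1}$. For integers $q\ge 1$, $p\ge 0$, let $$\bar{\mathcal W}=\underbrace{\mathcal W^*(k)\circ\cdots\circ\mathcal W^*(k)}_{q}\circ\underbrace{\mathcal W(k-1)\circ\cdots\circ\mathcal W(k-1)}_{p}.$$ Then $\mathcal R(\bar{\mathcal W})=\mathcal R(\mathcal W^*(k))$.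
   Context: Targets $\mathcal T=\{1,\dots,n\}$, $n\ge 2$; travel times $c(u,v)>0$ for distinct $u,v\in\mathcal T$ (set $c(u,u)=0$), satisfying $c(u,v)+c(v,w)\ge c(u,w)$ for all $u,v,w\in\mathcal T$. For an integer $k\ge n$, a closed walk with $k$ visits is a sequence $\mathcal W=(v_1,\dots,v_{k+1})$ of targets with $v_{k+1}=v_1$, $v_i\ne v_{i+1}$ for $1\le i\le k$, and every target appearing among $v_1,\dots,v_k$. The walk is repeated forever: extend it to the infinite periodic sequence $(v_i)_{i\ge 1}$ with $v_{i+k}=v_i$, where moving from $v_i$ to $v_{i+1}$ takes time $c(v_i,v_{i+1})$. For a target $d$, the revisit time $RT(d,\mathcal W)$ is the maximum, over all pairs of indices $i<j$ with $v_i=v_j=d$ and $v_l\ne d$ for $i<l<j$, of $\sum_{l=i}^{j-1}c(v_l,v_{l+1})$. The revisit time of the walk is $\mathcal R(\mathcal W)=\max_{d\in\mathcal T}RT(d,\mathcal W)$, and $\mathcal R^*(k)$ is the minimum of $\mathcal R(\mathcal W)$ over all closed walks with $k$ visits. Concatenation of closed walks with the same first node: $(d,a_1,\dots,a_k,d)\circ(d,b_1,\dots,b_l,d)=(d,a_1,\dots,a_k,d,b_1,\dots,b_l,d)$.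
   Formalization: The travel times c(u,v) take rational values. -}

module Defs where

open import Data.Nat using (ℕ; suc)
open import Data.Fin using (Fin; toℕ) renaming (_≟_ to _≟F_)
open import Data.List using (List; []; _∷_; _++_; [_]; length; lookup; drop; take; map; foldr; filter; allFin; head)
open import Data.List.Membership.Propositional using (_∈_)
open import Data.List.Relation.Unary.Linked using (Linked)
open import Data.Maybe using (Maybe; just)
open import Data.Product using (Σ; _×_; ∃-syntax)
open import Data.Rational using (ℚ; 0ℚ; _+_; _⊔_; _≤_; _<_)
open import Relation.Binary.PropositionalEquality using (_≡_; _≢_)
open import Relation.Nullary using (yes; no)

record Costs (n : ℕ) : Set where
  field
    c        : Fin n → Fin n → ℚ
    c-refl   : ∀ u → c u u ≡ 0ℚ
    c-pos    : ∀ u v → u ≢ v → 0ℚ < c u v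
    c-tri    : ∀ u v w → c u w ≤ c u v + c v w
open Costs public

-- A walk with k visits is represented by the list (v_1,...,v_k); the
-- closing node v_{k+1} = v_1 is implicit.  Concatenation of closed walks
-- with the same first node is then list append _++_.

record ClosedWalk {n : ℕ} (k : ℕ) (w : List (Fin n)) : Set where
  field
    len      : length w ≡ k
    adjDist  : Linked _≢_ (w ++ take 1 w)
    covers   : ∀ (d : Fin n) → d ∈ w
open ClosedWalk public

gapFrom : ∀ {n} → Costs n → Fin n → Fin n → List (Fin n) → ℚ
gapFrom C d x [] = 0ℚ
gapFrom C d x (y ∷ rest) with y ≟F d
... | yes _ = c C x y
... | no  _ = c C x y + gapFrom C d y rest

gap : ∀ {n} → Costs n → Fin n → List (Fin n) → ℚ
gap C d [] = 0ℚ
gap C d (x ∷ rest) = gapFrom C d x rest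

maxℚ : List ℚ → ℚ
maxℚ = foldr _⊔_ 0ℚ

-- RT(d, W): maximum over occurrences v_i = d (1 ≤ i ≤ k, which by
-- periodicity covers all occurrences of the infinite sequence) of the time
-- until the next visit of d.  The infinite periodic sequence starting at
-- position i is read off from w ++ w (the next visit occurs within k steps).
RT : ∀ {n} → Costs n → Fin n → List (Fin n) → ℚ
RT C d w =
  maxℚ (map (λ i → gap C d (drop (toℕ i) (w ++ w)))
            (filter (λ i → lookup w i ≟F d) (allFin (length w))))

R : ∀ {n} → Costs n → List (Fin n) → ℚ
R {n} C w = maxℚ (map (λ d → RT C d w) (allFin n))

IsOptimal : ∀ {n} → Costs n → ℕ → List (Fin n) → Set
IsOptimal {n} C k w =
  ClosedWalk k w × (∀ (w' : List (Fin n)) → ClosedWalk k w' → R C w ≤ R C w')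

-- w' is a shortcut walk of w: w = (v_1..v_{s-2}) ++ v_{s-1} ∷ v_s ∷ (v_{s+1}..v_k),
-- w' deletes v_s (so s ≥ 2, s ≤ k), v_s reappears at some t with s < t ≤ k+1,
-- and v_{s-1} ≠ v_{s+1} (where v_{k+1} = v_1).
Shortcut : ∀ {n} → List (Fin n) → List (Fin n) → Set
Shortcut {n} w w' =
  ∃[ xs ] ∃[ a ] ∃[ x ] ∃[ ys ]
    ( w ≡ xs ++ a ∷ x ∷ ys
    × w' ≡ xs ++ a ∷ ys
    × x ∈ ys ++ take 1 w
    × head (ys ++ w) ≢ just a )

rep : ∀ {A : Set} → ℕ → List A → List A
rep ℕ.zero w = []
rep (suc q) w = w ++ rep q w

{-# OPTIONS --safe #-}
module Submission where

-- Let L be the cycle cost of W*.  Every block of W̄ (a copy of W* or of its shortcut W) is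
-- a sublist of W* that starts at v₁ and visits every target, and the deleted entry recurs
-- later in W* or is v₁.  Hence the targets passed between two consecutive visits of d in
-- W̄ form a sublist of W* rotated to an occurrence of d, and by the triangle inequality
-- every revisit takes at most L.  Conversely, k < 2n forces a target d that W* visits
-- exactly once.  The shortcut keeps everything before or everything after that visit, so
-- the revisit of d leaving the first block, or entering it from the last one, runs through
-- all of W* and takes exactly L.  Thus R(W̄) = L = R(W*).

open import Defs
open import Data.Nat using (ℕ; zero; suc; _+_; _∸_; _*_; _≤_; _<_; z≤n; s≤s; _≤?_)
open import Data.Fin using (Fin; zero; suc; toℕ; _≟_; punchIn)
open import Data.List using (List; _++_; []; _∷_; [_]; allFin; concat; drop; length; lookup; replicate)
open import Relation.Binary.PropositionalEquality
  using (_≡_; _≢_; refl; sym; trans; cong; cong₂; subst; subst₂; module ≡-Reasoning)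

import Data.Nat.Properties as ℕ
open import Algebra.Properties.CommutativeMonoid.Sum ℕ.+-0-commutativeMonoid
  using (sum; sum-remove; ∑-distrib-+; sum-cong-≗; sum-replicate-zero)
open import Data.Bool using (if_then_else_)
open import Data.Fin.Properties using (punchInᵢ≢i; ¬∀⟶∃¬)
open import Data.List.Membership.Propositional using (_∈_; _∉_)
open import Data.List.Membership.Propositional.Properties
  using (∈-++⁺ˡ; ∈-++⁺ʳ; ∈-++⁻; ∈-∃++; ∈-insert; ∈-map⁺; ∈-filter⁺; ∈-allFin)
open import Data.List.Properties
  using (++-assoc; ++-identityʳ; ∷-injective; ∷-injectiveˡ; ∷-injectiveʳ; concat-++)
open import Data.List.Relation.Binary.Sublist.Propositional
  using (_⊆_; []; _∷_; _∷ʳ_; ⊆-refl; ⊆-trans; minimum)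
import Data.List.Relation.Binary.Sublist.Propositional as Sublist
open import Data.List.Relation.Binary.Sublist.Propositional.Properties using (++⁺; ++⁺ʳ)
open import Data.List.Relation.Unary.All using (All; []; _∷_)
import Data.List.Relation.Unary.All as All
import Data.List.Relation.Unary.All.Properties as Allₚ
open import Data.List.Relation.Unary.Any using (here; there)
open import Data.Product using (∃; ∃₂; _×_; _,_)
open import Data.Rational using (ℚ; 0ℚ) renaming (_+_ to _+ℚ_; _≤_ to _≤ℚ_)
import Data.Rational.Properties as ℚ
open import Data.Sum using (_⊎_; inj₁; inj₂; [_,_]′) renaming (map₂ to ⊎-map₂)
open import Function using (_∘_)
open import Relation.Nullary using (¬_; yes; no; does; contradiction)

module _ {A : Set} where

  occurrence-++ : ∀ (X Y : List A) {P d S} → X ++ Y ≡ P ++ d ∷ S →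
                  (∃ λ S′ → X ≡ P ++ d ∷ S′ × S ≡ S′ ++ Y) ⊎ (∃ λ P′ → Y ≡ P′ ++ d ∷ S × P ≡ X ++ P′)
  occurrence-++ [] Y {P} refl = inj₂ (P , refl , refl)
  occurrence-++ (x ∷ X) Y {[]} refl = inj₁ (X , refl , refl)
  occurrence-++ (x ∷ X) Y {p ∷ P} eq with ∷-injective eq
  ... | refl , eq′ with occurrence-++ X Y eq′
  ...   | inj₁ (S′ , X≡ , S≡) = inj₁ (S′ , cong (x ∷_) X≡ , S≡)
  ...   | inj₂ (P′ , Y≡ , P≡) = inj₂ (P′ , Y≡ , cong (x ∷_) P≡)

  ∈-++∷⁻ : ∀ (xs : List A) {x ys v} → v ∈ xs ++ x ∷ ys → v ≡ x ⊎ v ∈ xs ++ ys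
  ∈-++∷⁻ [] (here v≡x) = inj₁ v≡x
  ∈-++∷⁻ [] (there v∈ys) = inj₂ v∈ys
  ∈-++∷⁻ (y ∷ xs) (here v≡y) = inj₂ (here v≡y)
  ∈-++∷⁻ (y ∷ xs) (there v∈) = ⊎-map₂ there (∈-++∷⁻ xs v∈)

  ∉-∷ : ∀ {d y} {l : List A} → y ≢ d → d ∉ l → d ∉ y ∷ l
  ∉-∷ y≢d _ (here d≡y) = y≢d (sym d≡y)
  ∉-∷ _ d∉l (there d∈l) = d∉l d∈l

  ∉-++⁺ : ∀ {d} {xs ys : List A} → d ∉ xs → d ∉ ys → d ∉ xs ++ ys
  ∉-++⁺ {xs = xs} d∉xs d∉ys = [ d∉xs , d∉ys ]′ ∘ ∈-++⁻ xs

  ⊆-before-occurrence : ∀ (Q : List A) {T} P {S d} → Q ++ d ∷ T ⊆ P ++ d ∷ S → d ∉ Q → d ∉ S → Q ⊆ P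
  ⊆-before-occurrence [] P _ _ _ = minimum P
  ⊆-before-occurrence (q ∷ Q) [] (_ ∷ʳ τ) _ d∉S = contradiction (Sublist.lookup τ (∈-insert (q ∷ Q))) d∉S
  ⊆-before-occurrence (q ∷ Q) [] (refl ∷ _) d∉Q _ = contradiction (here refl) d∉Q
  ⊆-before-occurrence (q ∷ Q) (p ∷ P) (_ ∷ʳ τ) d∉Q d∉S = p ∷ʳ ⊆-before-occurrence (q ∷ Q) P τ d∉Q d∉S
  ⊆-before-occurrence (q ∷ Q) (p ∷ P) (refl ∷ τ) d∉Q d∉S =
    refl ∷ ⊆-before-occurrence Q P τ (d∉Q ∘ there) d∉S

  split-at-lookup : ∀ (w v : List A) {i d} → lookup w i ≡ d →
                    ∃₂ λ P S → w ≡ P ++ d ∷ S × drop (toℕ i) (w ++ v) ≡ d ∷ S ++ v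
  split-at-lookup (y ∷ w) v {zero} refl = [] , w , refl , refl
  split-at-lookup (y ∷ w) v {suc i} eq with split-at-lookup w v eq
  ... | P , S , w≡ , drop≡ = y ∷ P , S , cong (y ∷_) w≡ , drop≡

  lookup-at-split : ∀ P (d : A) S v →
                    ∃ λ i → lookup (P ++ d ∷ S) i ≡ d × drop (toℕ i) ((P ++ d ∷ S) ++ v) ≡ d ∷ S ++ v
  lookup-at-split [] d S v = zero , refl , refl
  lookup-at-split (y ∷ P) d S v with lookup-at-split P d S v
  ... | i , lookup≡ , drop≡ = suc i , lookup≡ , drop≡

  module _ (Block : List A → Set) where

    StartsWith : List A → Set
    StartsWith v = ∃₂ λ Z more → Block Z × v ≡ Z ++ more

    EndsWith : List A → Set
    EndsWith v = ∃₂ λ pre Z → Block Z × v ≡ pre ++ Z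

    concat-++-startsWith : ∀ {bs v} → All Block bs → StartsWith v → StartsWith (concat bs ++ v)
    concat-++-startsWith [] sv = sv
    concat-++-startsWith {X ∷ bs} {v} (bX ∷ _) _ = X , concat bs ++ v , bX , ++-assoc X (concat bs) v

    concat-endsWith : ∀ {X bs} → Block X → All Block bs → EndsWith (concat (X ∷ bs))
    concat-endsWith {X} bX [] = [] , X , bX , ++-identityʳ X
    concat-endsWith {X} _ (bY ∷ bbs) with concat-endsWith bY bbs
    ... | pre , Z , bZ , eq = X ++ pre , Z , bZ , trans (cong (X ++_) eq) (sym (++-assoc X pre Z))

rep-concat : ∀ {A : Set} q (w : List A) → rep q w ≡ concat (replicate q w)
rep-concat zero w = refl
rep-concat (suc q) w = cong (w ++_) (rep-concat q w)

maxℚ-upper : ∀ {x xs} → x ∈ xs → x ≤ℚ maxℚ xs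
maxℚ-upper {xs = y ∷ _} (here refl) = ℚ.p≤p⊔q y _
maxℚ-upper {xs = y ∷ _} (there x∈) = ℚ.≤-trans (maxℚ-upper x∈) (ℚ.p≤q⊔p y _)

maxℚ-least : ∀ {L xs} → 0ℚ ≤ℚ L → All (_≤ℚ L) xs → maxℚ xs ≤ℚ L
maxℚ-least 0≤L [] = 0≤L
maxℚ-least 0≤L (x≤L ∷ xs≤L) = ℚ.⊔-lub x≤L (maxℚ-least 0≤L xs≤L)

indicator : ∀ {m} → Fin m → Fin m → ℕ
indicator y d = if does (y ≟ d) then 1 else 0

indicator-diag : ∀ {m} (y : Fin m) → indicator y y ≡ 1
indicator-diag y with y ≟ y
... | yes _ = refl
... | no y≢y = contradiction refl y≢y

sum-indicator : ∀ {m} (y : Fin m) → sum (indicator y) ≡ 1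
sum-indicator {suc m} y = begin
  sum (indicator y)                              ≡⟨ sum-remove (indicator y) ⟩
  indicator y y + sum (indicator y ∘ punchIn y)  ≡⟨ cong₂ _+_ (indicator-diag y) off-diagonal-sum ⟩
  1                                              ∎
  where
  open ≡-Reasoning
  off-diagonal : ∀ j → indicator y (punchIn y j) ≡ 0
  off-diagonal j with y ≟ punchIn y j
  ... | yes y≡ = contradiction (sym y≡) (punchInᵢ≢i y j)
  ... | no _ = refl
  off-diagonal-sum : sum (indicator y ∘ punchIn y) ≡ 0
  off-diagonal-sum = trans (sum-cong-≗ off-diagonal) (sum-replicate-zero m)

module _ {m : ℕ} where

  visits : Fin m → List (Fin m) → ℕ
  visits d [] = 0
  visits d (y ∷ l) = indicator y d + visits d l

  sum-visits : ∀ l → sum (λ d → visits d l) ≡ length l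
  sum-visits [] = sum-replicate-zero m
  sum-visits (y ∷ l) =
    trans (∑-distrib-+ (indicator y) (λ d → visits d l)) (cong₂ _+_ (sum-indicator y) (sum-visits l))

  ∈⇒visits-pos : ∀ {d l} → d ∈ l → 0 < visits d l
  ∈⇒visits-pos {d} {_ ∷ l} (here refl) =
    subst (λ k → 0 < k + visits d l) (sym (indicator-diag d)) (s≤s z≤n)
  ∈⇒visits-pos {l = y ∷ _} (there d∈) = ℕ.≤-trans (∈⇒visits-pos d∈) (ℕ.m≤n+m _ (indicator y _))

  visits-middle : ∀ {d} A B → visits d (A ++ d ∷ B) ≡ suc (visits d (A ++ B))
  visits-middle {d} [] B = cong (_+ visits d B) (indicator-diag d)
  visits-middle {d} (y ∷ A) B =
    trans (cong (indicator y d +_) (visits-middle A B)) (ℕ.+-suc (indicator y d) _)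

sum-≥ : ∀ {m k} {f : Fin m → ℕ} → (∀ i → k ≤ f i) → m * k ≤ sum f
sum-≥ {zero} _ = z≤n
sum-≥ {suc m} k≤f = ℕ.+-mono-≤ (k≤f zero) (sum-≥ (k≤f ∘ suc))

visited-once : ∀ {m} (l : List (Fin m)) → (∀ d → d ∈ l) → length l < 2 * m →
               ∃ λ d → ∃₂ λ A B → l ≡ A ++ d ∷ B × d ∉ A × d ∉ B
visited-once {m} l covers short with ¬∀⟶∃¬ m (λ d → 2 ≤ visits d l) (λ d → 2 ≤? visits d l) not-all-twice
  where
  not-all-twice : ¬ (∀ d → 2 ≤ visits d l)
  not-all-twice twice = ℕ.<⇒≱ short (begin
    2 * m                    ≡⟨ ℕ.*-comm 2 m ⟩
    m * 2                    ≤⟨ sum-≥ twice ⟩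
    sum (λ d → visits d l)   ≡⟨ sum-visits l ⟩
    length l                 ∎)
    where open ℕ.≤-Reasoning
... | d , not-twice with ∈-∃++ (covers d)
...   | A , B , refl = d , A , B , refl , not-twice ∘ twice ∘ ∈-++⁺ˡ , not-twice ∘ twice ∘ ∈-++⁺ʳ A
  where
  twice : d ∈ A ++ B → 2 ≤ visits d (A ++ d ∷ B)
  twice d∈ = subst (2 ≤_) (sym (visits-middle A B)) (s≤s (∈⇒visits-pos d∈))

module _ {n : ℕ} (C : Costs n) where

  c-nonneg : ∀ u v → 0ℚ ≤ℚ c C u v
  c-nonneg u v with u ≟ v
  ... | yes refl = ℚ.≤-reflexive (sym (c-refl C u))
  ... | no u≢v = ℚ.<⇒≤ (c-pos C u v u≢v)

  pathCost : Fin n → List (Fin n) → ℚ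
  pathCost x [] = 0ℚ
  pathCost x (y ∷ l) = c C x y +ℚ pathCost y l

  pathCost-nonneg : ∀ x l → 0ℚ ≤ℚ pathCost x l
  pathCost-nonneg x [] = ℚ.≤-refl
  pathCost-nonneg x (y ∷ l) = ℚ.+-mono-≤ (c-nonneg x y) (pathCost-nonneg y l)

  pathCost-++ : ∀ x A z B → pathCost x (A ++ z ∷ B) ≡ pathCost x (A ++ [ z ]) +ℚ pathCost z B
  pathCost-++ x [] z B = cong (_+ℚ pathCost z B) (sym (ℚ.+-identityʳ (c C x z)))
  pathCost-++ x (y ∷ A) z B =
    trans (cong (c C x y +ℚ_) (pathCost-++ y A z B)) (sym (ℚ.+-assoc (c C x y) _ _))

  pathCost-detour : ∀ x z u l → pathCost x (u ∷ l) ≤ℚ c C x z +ℚ pathCost z (u ∷ l)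
  pathCost-detour x z u l = begin
    c C x u +ℚ pathCost u l               ≤⟨ ℚ.+-monoˡ-≤ (pathCost u l) (c-tri C x z u) ⟩
    (c C x z +ℚ c C z u) +ℚ pathCost u l  ≡⟨ ℚ.+-assoc (c C x z) (c C z u) (pathCost u l) ⟩
    c C x z +ℚ (c C z u +ℚ pathCost u l)  ∎
    where open ℚ.≤-Reasoning

  pathCost-mono-⊆ : ∀ {l l′} → l ⊆ l′ → ∀ x y → pathCost x (l ++ [ y ]) ≤ℚ pathCost x (l′ ++ [ y ])
  pathCost-mono-⊆ [] x y = ℚ.≤-refl
  pathCost-mono-⊆ {l} (z ∷ʳ τ) x y = ℚ.≤-trans (via l) (ℚ.+-monoʳ-≤ (c C x z) (pathCost-mono-⊆ τ z y))
    where
    via : ∀ l → pathCost x (l ++ [ y ]) ≤ℚ c C x z +ℚ pathCost z (l ++ [ y ])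
    via [] = pathCost-detour x z y []
    via (u ∷ l) = pathCost-detour x z u (l ++ [ y ])
  pathCost-mono-⊆ (refl ∷ τ) x y = ℚ.+-monoʳ-≤ (c C x _) (pathCost-mono-⊆ τ _ y)

  cycleCost : List (Fin n) → ℚ
  cycleCost [] = 0ℚ
  cycleCost (h ∷ t) = pathCost h (t ++ [ h ])

  cycleCost-nonneg : ∀ w → 0ℚ ≤ℚ cycleCost w
  cycleCost-nonneg [] = ℚ.≤-refl
  cycleCost-nonneg (h ∷ t) = pathCost-nonneg h (t ++ [ h ])

  cycleCost-rotate : ∀ P d S → cycleCost (P ++ d ∷ S) ≡ pathCost d ((S ++ P) ++ [ d ])
  cycleCost-rotate [] d S = cong (λ T → pathCost d (T ++ [ d ])) (sym (++-identityʳ S))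
  cycleCost-rotate (h ∷ P) d S = begin
    pathCost h ((P ++ d ∷ S) ++ [ h ])                  ≡⟨ cong (pathCost h) (++-assoc P (d ∷ S) [ h ]) ⟩
    pathCost h (P ++ d ∷ S ++ [ h ])                    ≡⟨ pathCost-++ h P d (S ++ [ h ]) ⟩
    pathCost h (P ++ [ d ]) +ℚ pathCost d (S ++ [ h ])  ≡⟨ ℚ.+-comm (pathCost h (P ++ [ d ])) _ ⟩
    pathCost d (S ++ [ h ]) +ℚ pathCost h (P ++ [ d ])  ≡⟨ pathCost-++ d S h (P ++ [ d ]) ⟨
    pathCost d (S ++ h ∷ P ++ [ d ])                    ≡⟨ cong (pathCost d) (++-assoc S (h ∷ P) [ d ]) ⟨
    pathCost d ((S ++ h ∷ P) ++ [ d ])                  ∎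
    where open ≡-Reasoning

  first-occurrence : ∀ (d : Fin n) l → d ∉ l ⊎ ∃₂ λ Q T → l ≡ Q ++ d ∷ T × d ∉ Q
  first-occurrence d [] = inj₁ λ ()
  first-occurrence d (y ∷ l) with y ≟ d
  ... | yes refl = inj₂ ([] , l , refl , λ ())
  ... | no y≢d with first-occurrence d l
  ...   | inj₁ d∉l = inj₁ (∉-∷ y≢d d∉l)
  ...   | inj₂ (Q , T , l≡ , d∉Q) = inj₂ (y ∷ Q , T , cong (y ∷_) l≡ , ∉-∷ y≢d d∉Q)

  gapFrom-first : ∀ {d} x Q T → d ∉ Q → gapFrom C d x (Q ++ d ∷ T) ≡ pathCost x (Q ++ [ d ])
  gapFrom-first {d} x [] T _ with d ≟ d
  ... | yes _ = sym (ℚ.+-identityʳ _)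
  ... | no d≢d = contradiction refl d≢d
  gapFrom-first {d} x (y ∷ Q) T d∉ with y ≟ d
  ... | yes y≡d = contradiction (here (sym y≡d)) d∉
  ... | no _ = cong (c C x y +ℚ_) (gapFrom-first y Q T (d∉ ∘ there))

  gapFrom-≤-cycleCost : ∀ {d w P S v T U} → w ≡ P ++ d ∷ S → v ≡ T ++ d ∷ U → d ∉ T → T ⊆ S ++ P →
                        gapFrom C d d v ≤ℚ cycleCost w
  gapFrom-≤-cycleCost {d} {P = P} {S} {T = T} {U} refl refl d∉T T⊆ = begin
    gapFrom C d d (T ++ d ∷ U)        ≡⟨ gapFrom-first d T U d∉T ⟩
    pathCost d (T ++ [ d ])           ≤⟨ pathCost-mono-⊆ T⊆ d d ⟩
    pathCost d ((S ++ P) ++ [ d ])    ≡⟨ cycleCost-rotate P d S ⟨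
    cycleCost (P ++ d ∷ S)            ∎
    where open ℚ.≤-Reasoning

  RT-≤ : ∀ d w {L} → 0ℚ ≤ℚ L → (∀ P S → w ≡ P ++ d ∷ S → gapFrom C d d (S ++ w) ≤ℚ L) → RT C d w ≤ℚ L
  RT-≤ d w {L} 0≤L gap≤L =
    maxℚ-least 0≤L (Allₚ.map⁺ (All.map bound (Allₚ.all-filter (λ i → lookup w i ≟ d) (allFin (length w)))))
    where
    bound : ∀ {i} → lookup w i ≡ d → gap C d (drop (toℕ i) (w ++ w)) ≤ℚ L
    bound lookup≡ with split-at-lookup w w lookup≡
    ... | P , S , w≡ , drop≡ = subst (λ v → gap C d v ≤ℚ L) (sym drop≡) (gap≤L P S w≡)

  gap-≤-RT : ∀ {d w} P S → w ≡ P ++ d ∷ S → gapFrom C d d (S ++ w) ≤ℚ RT C d w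
  gap-≤-RT {d} {w} P S refl with lookup-at-split P d S w
  ... | i , lookup≡ , drop≡ = subst (λ v → gap C d v ≤ℚ RT C d w) drop≡
    (maxℚ-upper (∈-map⁺ (λ i → gap C d (drop (toℕ i) (w ++ w)))
                        (∈-filter⁺ (λ i → lookup w i ≟ d) (∈-allFin i) lookup≡)))

  R-≤ : ∀ w {L} → 0ℚ ≤ℚ L → (∀ d → RT C d w ≤ℚ L) → R C w ≤ℚ L
  R-≤ w 0≤L RT≤L = maxℚ-least 0≤L (Allₚ.map⁺ (All.universal RT≤L (allFin n)))

  RT-≤-R : ∀ d w → RT C d w ≤ℚ R C w
  RT-≤-R d w = maxℚ-upper (∈-map⁺ (λ d → RT C d w) (∈-allFin d))

  module _ (Block : List (Fin n) → Set) {L : ℚ}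
           (gap≤L : ∀ {X Z P d S} → Block X → Block Z → X ≡ P ++ d ∷ S → ∀ more →
                    gapFrom C d d (S ++ Z ++ more) ≤ℚ L) where

    concat-gap-≤ : ∀ {bs v} → All Block bs → StartsWith Block v →
                   ∀ {P d S} → concat bs ≡ P ++ d ∷ S → gapFrom C d d (S ++ v) ≤ℚ L
    concat-gap-≤ [] _ {[]} ()
    concat-gap-≤ [] _ {_ ∷ _} ()
    concat-gap-≤ {X ∷ bs} {v} (bX ∷ bbs) sv {d = d} eq with occurrence-++ X (concat bs) eq
    ... | inj₂ (_ , bs≡ , _) = concat-gap-≤ bbs sv bs≡
    ... | inj₁ (S′ , X≡ , refl) with concat-++-startsWith Block bbs sv
    ...   | Z , more , bZ , bs++v≡ =
      subst (λ u → gapFrom C d d u ≤ℚ L) reassociate (gap≤L bX bZ X≡ more)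
      where
      reassociate : S′ ++ Z ++ more ≡ (S′ ++ concat bs) ++ v
      reassociate = trans (cong (S′ ++_) (sym bs++v≡)) (sym (++-assoc S′ (concat bs) v))

    R-concat-≤ : ∀ {X bs} → 0ℚ ≤ℚ L → Block X → All Block bs → R C (concat (X ∷ bs)) ≤ℚ L
    R-concat-≤ {X} {bs} 0≤L bX bbs =
      R-≤ (concat (X ∷ bs)) 0≤L λ d → RT-≤ d (concat (X ∷ bs)) 0≤L λ _ _ →
        concat-gap-≤ (bX ∷ bbs) (X , concat bs , bX , refl)

  module _ {X A B : List (Fin n)} {d : Fin n}
           (X≡ : X ≡ A ++ d ∷ B) (d∉A : d ∉ A) (d∉B : d ∉ B) where

    private
      gap-around : ∀ {v U} → v ≡ (B ++ A) ++ d ∷ U → gapFrom C d d v ≡ cycleCost X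
      gap-around {U = U} refl = begin
        gapFrom C d d ((B ++ A) ++ d ∷ U)   ≡⟨ gapFrom-first d (B ++ A) U (∉-++⁺ d∉B d∉A) ⟩
        pathCost d ((B ++ A) ++ [ d ])      ≡⟨ cycleCost-rotate A d B ⟨
        cycleCost (A ++ d ∷ B)              ≡⟨ cong cycleCost X≡ ⟨
        cycleCost X                         ∎
        where open ≡-Reasoning

    cycleCost-≤-RT-sharedPrefix : ∀ {bs} → All (λ Z → ∃ λ U → Z ≡ A ++ d ∷ U) bs →
                                  cycleCost X ≤ℚ RT C d (concat (X ∷ bs))
    cycleCost-≤-RT-sharedPrefix {bs} headed
      with concat-++-startsWith _ headed (X , concat bs , (B , X≡) , refl)
    ... | Z , more , (U , Z≡) , bs++W≡ =
      ℚ.≤-trans (ℚ.≤-reflexive (sym (gap-around continuation))) (gap-≤-RT A (B ++ concat bs) W≡)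
      where
      open ≡-Reasoning
      W≡ : concat (X ∷ bs) ≡ A ++ d ∷ B ++ concat bs
      W≡ = trans (cong (_++ concat bs) X≡) (++-assoc A (d ∷ B) (concat bs))
      continuation : (B ++ concat bs) ++ concat (X ∷ bs) ≡ (B ++ A) ++ d ∷ U ++ more
      continuation = begin
        (B ++ concat bs) ++ concat (X ∷ bs)   ≡⟨ ++-assoc B (concat bs) _ ⟩
        B ++ concat bs ++ concat (X ∷ bs)     ≡⟨ cong (B ++_) (trans bs++W≡ (cong (_++ more) Z≡)) ⟩
        B ++ (A ++ d ∷ U) ++ more             ≡⟨ cong (B ++_) (++-assoc A (d ∷ U) more) ⟩
        B ++ A ++ d ∷ U ++ more               ≡⟨ ++-assoc B A _ ⟨
        (B ++ A) ++ d ∷ U ++ more             ∎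

    cycleCost-≤-RT-sharedSuffix : ∀ {bs} → All (λ Z → ∃ λ V → Z ≡ V ++ d ∷ B) bs →
                                  cycleCost X ≤ℚ RT C d (concat (X ∷ bs))
    cycleCost-≤-RT-sharedSuffix {bs} tailed with concat-endsWith _ (A , X≡) tailed
    ... | pre , Z , (V , Z≡) , W≡ =
      ℚ.≤-trans (ℚ.≤-reflexive (sym (gap-around continuation))) (gap-≤-RT (pre ++ V) B W≡′)
      where
      open ≡-Reasoning
      W≡′ : concat (X ∷ bs) ≡ (pre ++ V) ++ d ∷ B
      W≡′ = trans W≡ (trans (cong (pre ++_) Z≡) (sym (++-assoc pre V (d ∷ B))))
      continuation : B ++ concat (X ∷ bs) ≡ (B ++ A) ++ d ∷ B ++ concat bs
      continuation = begin
        B ++ X ++ concat bs                ≡⟨ cong (λ Y → B ++ Y ++ concat bs) X≡ ⟩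
        B ++ (A ++ d ∷ B) ++ concat bs     ≡⟨ cong (B ++_) (++-assoc A (d ∷ B) (concat bs)) ⟩
        B ++ A ++ d ∷ B ++ concat bs       ≡⟨ ++-assoc B A _ ⟨
        (B ++ A) ++ d ∷ B ++ concat bs     ∎

  -- w is W* with the deleted entry x made explicit: x is not the first entry h, and it
  -- recurs in ys or is the closing node v_{k+1} = h.
  module ShortcutBlocks (h : Fin n) (us : List (Fin n)) (x : Fin n) (ys : List (Fin n))
                        (x∈ : x ∈ ys ++ [ h ]) where

    w w′ : List (Fin n)
    w = h ∷ us ++ x ∷ ys
    w′ = h ∷ us ++ ys

    data Block : List (Fin n) → Set where
      original  : Block w
      shortened : Block w′

    Block-⊆ : ∀ {Z} → Block Z → Z ⊆ w
    Block-⊆ original = ⊆-refl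
    Block-⊆ shortened = refl ∷ ++⁺ ⊆-refl (x ∷ʳ ⊆-refl)

    Block-head : ∀ {Z} → Block Z → ∃ λ t → Z ≡ h ∷ t
    Block-head original = _ , refl
    Block-head shortened = _ , refl

    x∈w′ : x ∈ w′
    x∈w′ with ∈-++⁻ ys x∈
    ... | inj₁ x∈ys = there (∈-++⁺ʳ us x∈ys)
    ... | inj₂ (here x≡h) = here x≡h

    Block-covers : (∀ d → d ∈ w) → ∀ {Z} → Block Z → ∀ d → d ∈ Z
    Block-covers covers original = covers
    Block-covers covers shortened d with covers d
    ... | here d≡h = here d≡h
    ... | there d∈ = [ (λ d≡x → subst (_∈ w′) (sym d≡x) x∈w′) , there ]′ (∈-++∷⁻ us d∈)

    -- The lifted visit of d is again the last one, unless d is the deleted entry, and then d = h.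
    lift-occurrence : ∀ {Z P d S} → Block Z → Z ≡ P ++ d ∷ S →
                      ∃₂ λ P′ S′ → w ≡ P′ ++ d ∷ S′ × S ⊆ S′ × (d ∉ S → d ∉ S′ ⊎ d ≡ h)
    lift-occurrence original Z≡ = _ , _ , Z≡ , ⊆-refl , inj₁
    lift-occurrence {P = P} {d} shortened Z≡ with occurrence-++ (h ∷ us) ys Z≡
    ... | inj₁ (S′ , hus≡ , refl) = P , S′ ++ x ∷ ys , w≡ , ++⁺ ⊆-refl (x ∷ʳ ⊆-refl) , still-last
      where
      w≡ : w ≡ P ++ d ∷ S′ ++ x ∷ ys
      w≡ = trans (cong (_++ x ∷ ys) hus≡) (++-assoc P (d ∷ S′) (x ∷ ys))
      still-last : d ∉ S′ ++ ys → d ∉ S′ ++ x ∷ ys ⊎ d ≡ h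
      still-last d∉ with x ≟ d | ∈-++⁻ ys x∈
      ... | no x≢d | _ = inj₁ ([ (λ d≡x → x≢d (sym d≡x)) , d∉ ]′ ∘ ∈-++∷⁻ S′)
      ... | yes x≡d | inj₁ x∈ys = contradiction (∈-++⁺ʳ S′ (subst (_∈ ys) x≡d x∈ys)) d∉
      ... | yes x≡d | inj₂ (here x≡h) = inj₂ (trans (sym x≡d) x≡h)
    ... | inj₂ (P′ , ys≡ , refl) = (h ∷ us) ++ x ∷ P′ , _ , w≡ , ⊆-refl , inj₁
      where
      w≡ : w ≡ ((h ∷ us) ++ x ∷ P′) ++ d ∷ _
      w≡ = trans (cong (λ t → (h ∷ us) ++ x ∷ t) ys≡) (sym (++-assoc (h ∷ us) (x ∷ P′) _))

    first-visit-⊆ : ∀ {Z Q T d P′ S′} → Block Z → Z ≡ Q ++ d ∷ T → d ∉ Q →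
                    w ≡ P′ ++ d ∷ S′ → d ∉ S′ ⊎ d ≡ h → Q ⊆ P′
    first-visit-⊆ {Q = Q} {P′ = P′} bZ Z≡ d∉Q w≡ (inj₁ d∉S′) =
      ⊆-before-occurrence Q P′ (subst₂ _⊆_ Z≡ w≡ (Block-⊆ bZ)) d∉Q d∉S′
    first-visit-⊆ {Q = []} _ _ _ _ (inj₂ _) = minimum _
    first-visit-⊆ {Q = q ∷ Q} bZ Z≡ d∉Q _ (inj₂ d≡h) with Block-head bZ
    ... | _ , Z≡h∷ = contradiction (here (trans d≡h (∷-injectiveˡ (trans (sym Z≡h∷) Z≡)))) d∉Q

    gap-between-blocks : (∀ d → d ∈ w) → ∀ {X Z P d S} → Block X → Block Z → X ≡ P ++ d ∷ S → ∀ more →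
                         gapFrom C d d (S ++ Z ++ more) ≤ℚ cycleCost w
    gap-between-blocks covers {Z = Z} {d = d} {S} bX bZ X≡ more with lift-occurrence bX X≡
    ... | P′ , S′ , w≡ , S⊆S′ , lift-∉ with first-occurrence d S
    ...   | inj₂ (Q , T , S≡ , d∉Q) =
      gapFrom-≤-cycleCost w≡ continuation d∉Q (⊆-trans Q⊆S (⊆-trans S⊆S′ (++⁺ʳ P′ ⊆-refl)))
      where
      continuation : S ++ Z ++ more ≡ Q ++ d ∷ T ++ Z ++ more
      continuation = trans (cong (_++ Z ++ more) S≡) (++-assoc Q (d ∷ T) (Z ++ more))
      Q⊆S : Q ⊆ S
      Q⊆S = subst (Q ⊆_) (sym S≡) (++⁺ʳ (d ∷ T) ⊆-refl)
    ...   | inj₁ d∉S with first-occurrence d Z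
    ...     | inj₁ d∉Z = contradiction (Block-covers covers bZ d) d∉Z
    ...     | inj₂ (Q , T , Z≡ , d∉Q) =
      gapFrom-≤-cycleCost w≡ continuation (∉-++⁺ d∉S d∉Q)
                          (++⁺ S⊆S′ (first-visit-⊆ bZ Z≡ d∉Q w≡ (lift-∉ d∉S)))
      where
      continuation : S ++ Z ++ more ≡ (S ++ Q) ++ d ∷ T ++ more
      continuation = trans (cong (λ Y → S ++ Y ++ more) Z≡)
                     (trans (cong (S ++_) (++-assoc Q (d ∷ T) more)) (sym (++-assoc S Q _)))

    keeps-prefix-or-suffix : ∀ {A d B} → w ≡ A ++ d ∷ B → d ∉ A → d ∉ B →
                             (∃ λ B′ → w′ ≡ A ++ d ∷ B′) ⊎ (∃ λ A′ → w′ ≡ A′ ++ d ∷ B)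
    keeps-prefix-or-suffix {A} {d} w≡ d∉A d∉B with occurrence-++ (h ∷ us) (x ∷ ys) w≡
    ... | inj₁ (B′ , hus≡ , refl) = inj₁ (B′ ++ ys , trans (cong (_++ ys) hus≡) (++-assoc A (d ∷ B′) ys))
    ... | inj₂ ([] , x∷ys≡ , refl) with ∷-injective x∷ys≡ | ∈-++⁻ ys x∈
    ...   | x≡d , ys≡B | inj₁ x∈ys = contradiction (subst₂ _∈_ x≡d ys≡B x∈ys) d∉B
    ...   | x≡d , _ | inj₂ (here x≡h) = contradiction (here (trans (sym x≡d) x≡h)) d∉A
    keeps-prefix-or-suffix {d = d} {B} _ _ _ | inj₂ (_ ∷ P′ , x∷ys≡ , refl) =
      inj₂ ((h ∷ us) ++ P′ ,
            trans (cong ((h ∷ us) ++_) (∷-injectiveʳ x∷ys≡)) (sym (++-assoc (h ∷ us) P′ (d ∷ B))))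

    cycleCost-≤-R : (∀ d → d ∈ w) → length w < 2 * n → ∀ {bs} → All Block bs →
                    cycleCost w ≤ℚ R C (concat (w ∷ bs))
    cycleCost-≤-R covers short {bs} bbs with visited-once w covers short
    ... | d , A , B , w≡ , d∉A , d∉B = ℚ.≤-trans cycleCost-≤-RT (RT-≤-R d (concat (w ∷ bs)))
      where
      cycleCost-≤-RT : cycleCost w ≤ℚ RT C d (concat (w ∷ bs))
      cycleCost-≤-RT with keeps-prefix-or-suffix w≡ d∉A d∉B
      ... | inj₁ (B′ , w′≡) = cycleCost-≤-RT-sharedPrefix w≡ d∉A d∉B
                                (All.map (λ { original → B , w≡ ; shortened → B′ , w′≡ }) bbs)
      ... | inj₂ (A′ , w′≡) = cycleCost-≤-RT-sharedSuffix w≡ d∉A d∉B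
                                (All.map (λ { original → A , w≡ ; shortened → A′ , w′≡ }) bbs)

    R-concat : (∀ d → d ∈ w) → length w < 2 * n → ∀ {bs} → All Block bs →
               R C (concat (w ∷ bs)) ≡ cycleCost w
    R-concat covers short bbs = ℚ.≤-antisym
      (R-concat-≤ Block (gap-between-blocks covers) (cycleCost-nonneg w) original bbs)
      (cycleCost-≤-R covers short bbs)

    R-rep : (∀ d → d ∈ w) → length w < 2 * n → ∀ q p → R C (rep (suc q) w ++ rep p w′) ≡ R C w
    R-rep covers short q p = begin
      R C (rep (suc q) w ++ rep p w′)  ≡⟨ cong (R C) blocks ⟩
      R C (concat (w ∷ bs))            ≡⟨ R-concat covers short (Allₚ.++⁺ (Allₚ.replicate⁺ q original)
                                                                           (Allₚ.replicate⁺ p shortened)) ⟩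
      cycleCost w                      ≡⟨ R-concat covers short [] ⟨
      R C (concat (w ∷ []))            ≡⟨ cong (R C) (++-identityʳ w) ⟩
      R C w                            ∎
      where
      open ≡-Reasoning
      bs : List (List (Fin n))
      bs = replicate q w ++ replicate p w′
      blocks : rep (suc q) w ++ rep p w′ ≡ concat (w ∷ bs)
      blocks = trans (cong₂ _++_ (rep-concat (suc q) w) (rep-concat p w′))
                     (concat-++ (replicate (suc q) w) (replicate p w′))

shortcut-normal : ∀ {n} {w w′ : List (Fin n)} → Shortcut w w′ →
                  ∃₂ λ h us → ∃₂ λ x ys → w ≡ h ∷ us ++ x ∷ ys × w′ ≡ h ∷ us ++ ys × x ∈ ys ++ [ h ]
shortcut-normal ([] , a , x , ys , refl , refl , x∈ , _) = a , [] , x , ys , refl , refl , x∈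
shortcut-normal (h ∷ xs , a , x , ys , refl , refl , x∈ , _) =
  h , xs ++ [ a ] , x , ys ,
  cong (h ∷_) (sym (++-assoc xs [ a ] (x ∷ ys))) , cong (h ∷_) (sym (++-assoc xs [ a ] ys)) , x∈

lemma6 : (n : ℕ) → 2 ≤ n → (C : Costs n) → (k : ℕ) → suc n ≤ k → k ≤ 2 * n ∸ 1 →
         (Wstar W : List (Fin n)) → IsOptimal C k Wstar → Shortcut Wstar W →
         (q p : ℕ) → 1 ≤ q →
         R C (rep q Wstar ++ rep p W) ≡ R C Wstar
lemma6 (suc n) (s≤s _) C k _ k≤ Wstar W (walk , _) shortcut (suc q) p _ with shortcut-normal shortcut
... | h , us , x , ys , refl , refl , x∈ = R-rep (covers walk) short q p
  where
  open ShortcutBlocks C h us x ys x∈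
  -- 2 * suc n ∸ 1 reduces to the predecessor of 2 * suc n, so s≤s turns k≤ into k < 2 * suc n.
  short : length w < 2 * suc n
  short = subst (_< 2 * suc n) (sym (len walk)) (s≤s k≤)
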